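{- Let $k\ge 2$ and let $v_1>v_2>\dots>v_k>0$ be integers with $\gcd(v_1,\dots,v_k)=d$. Then every integer that is greater than $2\left\lfloor \frac{v_1}{dk}\right\rfloor v_2 - v_1$ and divisible by $d$ can be expressed as $\sum_{i=1}^k c_i v_i$ with $c_1,\dots,c_k$ nonnegative integers. -}

module Defs where

open import Data.Nat using (ℕ; zero; suc; _*_)
open import Data.Nat.DivMod using (_/_)
open import Data.Nat.GCD using (gcd)
open import Data.Fin using (Fin)
open import Data.Vec.Functional using (Vector; foldr)

gcdAll : ∀ {k} → Vector ℕ k → ℕ
gcdAll v = foldr gcd 0 v

-- floor division a / b for b > 0 (returns 0 when b = 0; only used with b > 0)
_div_ : ℕ → ℕ → ℕ
a div zero = 0
a div (suc b) = a / suc b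

-- Dividing by d we may assume gcd(v₁,…,v_k) = 1. Put A = v₁ and let B ⊆ ℤ/Aℤ be the residues of
-- v₁,…,v_k: k distinct residues, containing 0, generating ℤ/Aℤ. For every proper nonempty X, the
-- erosion X ⊖ B = {x : x + B ⊆ X} satisfies |X ⊖ B| + k ≤ |X + B|. Otherwise take a counterexample
-- minimising first gap X = |X + B| − |X ⊖ B| and then |X|. Since −(ℤ/Aℤ ∖ X) has the same gap,
-- 2|X| ≤ A; then for x, y ∈ X the set X ∩ (X − (x − y)) is proper, and submodularity of the gap
-- forces it to be X, so X is closed under its own differences. A point of X ⊖ B would therefore make
-- X invariant under B, i.e. X = ℤ/Aℤ; so X ⊖ B = ∅ and |X + B| ≥ k. As hB ⊆ (h+1)B ⊖ B, the h-fold
-- sumsets gain k elements every two steps, so 2⌊A/k⌋B = ℤ/Aℤ: every residue mod A is a sum of at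
-- most 2⌊A/k⌋ of v₂,…,v_k, hence ≤ 2⌊A/k⌋v₂. Adding multiples of v₁ reaches every larger integer
-- in its class, i.e. every integer > 2⌊A/k⌋v₂ − A.

module Submission where

open import Level using (0ℓ)
open import Algebra.Bundles using (AbelianGroup)
open import Algebra.Core using (Op₁; Op₂)
open import Algebra.Structures using (IsAbelianGroup)
open import Data.Bool.Base using (Bool; true; false; T; not; _∧_; _∨_)
open import Data.Bool.Properties using (T-∧; T-∨)
open import Data.Empty using (⊥-elim)
open import Data.Fin.Base using (Fin; zero; suc; toℕ; fromℕ; punchIn; punchOut)
import Data.Fin.Base as F
open import Data.Fin.Properties
  using (_≟_; any?; all?; ¬∀⟶∃¬; punchIn-punchOut; punchOut-injective; suc-injective; 0≢1+n;
         toℕ-injective; toℕ<n; toℕ-fromℕ<; <-cmp; ≤fromℕ; ≤∧≢⇒<)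
open import Data.Fin.Permutation using (permutation)
open import Data.Nat.Base
  using (ℕ; zero; suc; pred; _+_; _*_; _∸_; _≤_; _<_; z≤n; s≤s; z<s; s<s; NonZero; >-nonZero; >-nonZero⁻¹)
open import Data.Nat.Properties hiding (_≟_; suc-injective; 0≢1+n; <-cmp; ≤∧≢⇒<)
open import Data.Nat.DivMod
  using (_/_; _%_; _mod_; m%n<n; m<n⇒m%n≡m; %-distribˡ-+; n%n≡0; m*n%n≡0; m≡m%n+[m/n]*n; m/n*n≡m; m*n/m*o≡n/o)
import Data.Nat.Divisibility as ℕ
open import Data.Nat.GCD using (gcd; gcd-GCD; module Bézout; gcd[m,n]∣m; gcd[m,n]∣n; c*gcd[m,n]≡gcd[cm,cn])
open import Data.Nat.Induction using (<-wellFounded)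
open import Data.Product using (∃; _,_; _×_; proj₁; proj₂)
import Data.Product
open import Data.Sum using (_⊎_; inj₁; inj₂)
import Data.Sum
open import Data.Vec.Functional using (Vector; updateAt)
open import Function.Base using (_∘_)
open import Function.Bundles using (Equivalence)
open import Function.Definitions using (Injective; StrictlyInverseˡ; StrictlyInverseʳ)
open import Induction.WellFounded using (module All)
open import Relation.Binary.Definitions using (tri<; tri≈; tri>)
open import Relation.Binary.PropositionalEquality
import Relation.Binary.Construct.On as On
open import Relation.Nullary using (¬_; Dec; yes; no; contradiction)
open import Relation.Nullary.Decidable using (T?; map′; ⌊_⌋; toWitness; fromWitness)
open import Algebra.Properties.CommutativeMonoid.Sum +-0-commutativeMonoid
  using (sum; sum-cong-≗; sum-replicate-zero; ∑-distrib-+; sum-remove; sum-permute)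
open import Algebra.Properties.CommutativeSemigroup +-commutativeSemigroup using (interchange; x∙yz≈y∙xz)

open import Defs

private variable
  n : ℕ

-- Finite sets and their sizes

Subset : ℕ → Set
Subset n = Fin n → Bool

infix 4 _∈_ _∉_ _∈?_ _⊆_
infixr 7 _∩_
infixr 6 _∪_

-- A record rather than T (X x), so that x and X can be inferred from a membership proof.
record _∈_ (x : Fin n) (X : Subset n) : Set where
  constructor mk∈
  field ∈⇒T : T (X x)
open _∈_ public

_∉_ : Fin n → Subset n → Set
x ∉ X = ¬ x ∈ X

_∈?_ : ∀ x (X : Subset n) → Dec (x ∈ X)
x ∈? X = map′ mk∈ ∈⇒T (T? (X x))

_⊆_ : Subset n → Subset n → Set
X ⊆ Y = ∀ {x} → x ∈ X → x ∈ Y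

_∩_ _∪_ : Subset n → Subset n → Subset n
(X ∩ Y) x = X x ∧ Y x
(X ∪ Y) x = X x ∨ Y x

⊤ ⊥ : Subset n
⊤ _ = true
⊥ _ = false

⁅_⁆ : Fin n → Subset n
⁅ x ⁆ y = ⌊ y ≟ x ⌋

∁ : Subset n → Subset n
∁ X x = not (X x)

χ : Bool → ℕ
χ true  = 1
χ false = 0

∣_∣ : Subset n → ℕ
∣ X ∣ = sum (χ ∘ X)

private variable
  X Y P Q : Subset n

module _ {m} {f : Fin m → Fin n} {x : Fin m} where

  x∈X∘f⁺ : f x ∈ X → x ∈ X ∘ f
  x∈X∘f⁺ (mk∈ fx∈X) = mk∈ fx∈X

  x∈X∘f⁻ : x ∈ X ∘ f → f x ∈ X
  x∈X∘f⁻ (mk∈ x∈X∘f) = mk∈ x∈X∘f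

⊆-∘ : ∀ {m} (f : Fin m → Fin n) → X ⊆ Y → X ∘ f ⊆ Y ∘ f
⊆-∘ f X⊆Y = x∈X∘f⁺ ∘ X⊆Y ∘ x∈X∘f⁻

χ-mono : ∀ {a b} → (T a → T b) → χ a ≤ χ b
χ-mono {false}         _   = z≤n
χ-mono {true}  {true}  _   = ≤-refl
χ-mono {true}  {false} a⇒b = ⊥-elim (a⇒b _)

χ-T : ∀ {a} → T a → χ a ≡ 1
χ-T {true} _ = refl

χ-¬T : ∀ {a} → ¬ T a → χ a ≡ 0
χ-¬T {false} _   = refl
χ-¬T {true}  ¬Ta = contradiction _ ¬Ta

∣∣-mono : X ⊆ Y → ∣ X ∣ ≤ ∣ Y ∣
∣∣-mono {zero}  X⊆Y = z≤n
∣∣-mono {suc n} X⊆Y = +-mono-≤ (χ-mono (∈⇒T ∘ X⊆Y {zero} ∘ mk∈)) (∣∣-mono (⊆-∘ suc X⊆Y))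

∣∣-cong : X ⊆ Y → Y ⊆ X → ∣ X ∣ ≡ ∣ Y ∣
∣∣-cong X⊆Y Y⊆X = ≤-antisym (∣∣-mono X⊆Y) (∣∣-mono Y⊆X)

∣⊤∣ : ∀ n → ∣ ⊤ {n} ∣ ≡ n
∣⊤∣ zero    = refl
∣⊤∣ (suc n) = cong suc (∣⊤∣ n)

∣∣≤n : ∀ (X : Subset n) → ∣ X ∣ ≤ n
∣∣≤n {n} X = subst (∣ X ∣ ≤_) (∣⊤∣ n) (∣∣-mono {X = X} {Y = ⊤} _)

empty⇒∣∣≡0 : (∀ x → x ∉ X) → ∣ X ∣ ≡ 0
empty⇒∣∣≡0 {n} {X} X-empty =
  n≤0⇒n≡0 (subst (∣ X ∣ ≤_) (sum-replicate-zero n)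
    (∣∣-mono {X = X} {Y = ⊥} λ {x} x∈X → contradiction x∈X (X-empty x)))

∣∪∣+∣∩∣ : ∀ (X Y : Subset n) → ∣ X ∪ Y ∣ + ∣ X ∩ Y ∣ ≡ ∣ X ∣ + ∣ Y ∣
∣∪∣+∣∩∣ X Y = begin
  ∣ X ∪ Y ∣ + ∣ X ∩ Y ∣                ≡⟨ ∑-distrib-+ (χ ∘ (X ∪ Y)) (χ ∘ (X ∩ Y)) ⟨
  sum (λ x → χ (X x ∨ Y x) + χ (X x ∧ Y x)) ≡⟨ sum-cong-≗ (λ x → χ-∨+χ-∧ (X x) (Y x)) ⟩
  sum (λ x → χ (X x) + χ (Y x))         ≡⟨ ∑-distrib-+ (χ ∘ X) (χ ∘ Y) ⟩
  ∣ X ∣ + ∣ Y ∣                         ∎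
  where
  open ≡-Reasoning
  χ-∨+χ-∧ : ∀ a b → χ (a ∨ b) + χ (a ∧ b) ≡ χ a + χ b
  χ-∨+χ-∧ true  true  = refl
  χ-∨+χ-∧ true  false = refl
  χ-∨+χ-∧ false true  = refl
  χ-∨+χ-∧ false false = refl

∣∁∣+∣∣ : ∀ (X : Subset n) → ∣ ∁ X ∣ + ∣ X ∣ ≡ n
∣∁∣+∣∣ {n} X = begin
  ∣ ∁ X ∣ + ∣ X ∣                ≡⟨ ∑-distrib-+ (χ ∘ ∁ X) (χ ∘ X) ⟨
  sum (λ x → χ (not (X x)) + χ (X x)) ≡⟨ sum-cong-≗ (χ-not+χ ∘ X) ⟩
  ∣ ⊤ {n} ∣                       ≡⟨ ∣⊤∣ n ⟩
  n                               ∎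
  where
  open ≡-Reasoning
  χ-not+χ : ∀ a → χ (not a) + χ a ≡ 1
  χ-not+χ true  = refl
  χ-not+χ false = refl

∣∣-+-≤-∩∪ : P ⊆ X ∩ Y → Q ⊆ X ∪ Y → ∣ P ∣ + ∣ Q ∣ ≤ ∣ X ∣ + ∣ Y ∣
∣∣-+-≤-∩∪ {P = P} {X = X} {Y = Y} {Q = Q} P⊆X∩Y Q⊆X∪Y = begin
  ∣ P ∣ + ∣ Q ∣         ≤⟨ +-mono-≤ (∣∣-mono P⊆X∩Y) (∣∣-mono Q⊆X∪Y) ⟩
  ∣ X ∩ Y ∣ + ∣ X ∪ Y ∣ ≡⟨ +-comm ∣ X ∩ Y ∣ ∣ X ∪ Y ∣ ⟩
  ∣ X ∪ Y ∣ + ∣ X ∩ Y ∣ ≡⟨ ∣∪∣+∣∩∣ X Y ⟩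
  ∣ X ∣ + ∣ Y ∣         ∎
  where open ≤-Reasoning

∣∣-+-≥-∩∪ : X ∩ Y ⊆ P → X ∪ Y ⊆ Q → ∣ X ∣ + ∣ Y ∣ ≤ ∣ P ∣ + ∣ Q ∣
∣∣-+-≥-∩∪ {X = X} {Y = Y} {P = P} {Q = Q} X∩Y⊆P X∪Y⊆Q = begin
  ∣ X ∣ + ∣ Y ∣         ≡⟨ ∣∪∣+∣∩∣ X Y ⟨
  ∣ X ∪ Y ∣ + ∣ X ∩ Y ∣ ≡⟨ +-comm ∣ X ∪ Y ∣ ∣ X ∩ Y ∣ ⟩
  ∣ X ∩ Y ∣ + ∣ X ∪ Y ∣ ≤⟨ +-mono-≤ (∣∣-mono X∩Y⊆P) (∣∣-mono X∪Y⊆Q) ⟩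
  ∣ P ∣ + ∣ Q ∣         ∎
  where open ≤-Reasoning

∣∣-remove : ∀ (X : Subset (suc n)) x → ∣ X ∣ ≡ χ (X x) + ∣ X ∘ punchIn x ∣
∣∣-remove X x = sum-remove {i = x} (χ ∘ X)

∈⇒0<∣∣ : ∀ {x} → x ∈ X → 0 < ∣ X ∣
∈⇒0<∣∣ {suc n} {X} {x} x∈X = begin-strict
  0                           <⟨ s≤s z≤n ⟩
  1 + ∣ X ∘ punchIn x ∣       ≡⟨ cong (_+ ∣ X ∘ punchIn x ∣) (χ-T (∈⇒T x∈X)) ⟨
  χ (X x) + ∣ X ∘ punchIn x ∣ ≡⟨ ∣∣-remove X x ⟨
  ∣ X ∣                       ∎
  where open ≤-Reasoning

⊆∧∣∣≤⇒⊇ : X ⊆ Y → ∣ Y ∣ ≤ ∣ X ∣ → Y ⊆ X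
⊆∧∣∣≤⇒⊇ {suc n} {X} {Y} X⊆Y ∣Y∣≤∣X∣ {y} y∈Y with y ∈? X
... | yes y∈X = y∈X
... | no  y∉X = contradiction ∣Y∣≤∣X∣ (<⇒≱ (begin-strict
  ∣ X ∣                               ≡⟨ ∣∣-remove X y ⟩
  χ (X y) + ∣ X ∘ punchIn y ∣         ≡⟨ cong (_+ ∣ X ∘ punchIn y ∣) (χ-¬T (y∉X ∘ mk∈)) ⟩
  ∣ X ∘ punchIn y ∣                   <⟨ s≤s (∣∣-mono (⊆-∘ (punchIn y) X⊆Y)) ⟩
  1 + ∣ Y ∘ punchIn y ∣               ≡⟨ cong (_+ ∣ Y ∘ punchIn y ∣) (χ-T (∈⇒T y∈Y)) ⟨
  χ (Y y) + ∣ Y ∘ punchIn y ∣         ≡⟨ ∣∣-remove Y y ⟨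
  ∣ Y ∣                               ∎))
  where open ≤-Reasoning

∣∣<n⇒∃∉ : ∀ {n} {X : Subset n} → ∣ X ∣ < n → ∃ λ x → x ∉ X
∣∣<n⇒∃∉ {n} {X} ∣X∣<n = ¬∀⟶∃¬ n (_∈ X) (_∈? X) λ X-full →
  <⇒≱ ∣X∣<n (subst (_≤ ∣ X ∣) (∣⊤∣ n) (∣∣-mono (λ {x} _ → X-full x)))

∣∣-∘-inverse : ∀ (X : Subset n) {f g : Fin n → Fin n} →
               StrictlyInverseˡ _≡_ f g → StrictlyInverseʳ _≡_ f g → ∣ X ∘ f ∣ ≡ ∣ X ∣
∣∣-∘-inverse X {f} {g} f∘g≗id g∘f≗id = sym (sum-permute (χ ∘ X) (permutation f g f∘g≗id g∘f≗id))

injective⇒≤∣∣ : ∀ {k} (X : Subset n) (f : Fin k → Fin n) →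
                Injective _≡_ _≡_ f → (∀ i → f i ∈ X) → k ≤ ∣ X ∣
injective⇒≤∣∣ {k = zero}          X f f-inj f∈X = z≤n
injective⇒≤∣∣ {zero}  {k = suc k} X f f-inj f∈X with () ← f zero
injective⇒≤∣∣ {suc n} {k = suc k} X f f-inj f∈X = begin
  suc k                         ≤⟨ s≤s (injective⇒≤∣∣ (X ∘ punchIn (f zero)) g g-inj g∈X) ⟩
  suc ∣ X ∘ punchIn (f zero) ∣  ≡⟨ cong (_+ ∣ X ∘ punchIn (f zero) ∣) (χ-T (∈⇒T (f∈X zero))) ⟨
  χ (X (f zero)) + ∣ X ∘ punchIn (f zero) ∣ ≡⟨ ∣∣-remove X (f zero) ⟨
  ∣ X ∣                         ∎
  where
  open ≤-Reasoning
  f₀≢f₊ : ∀ i → f zero ≢ f (suc i)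
  f₀≢f₊ i = λ eq → 0≢1+n (f-inj eq)
  g : Fin k → Fin n
  g i = punchOut (f₀≢f₊ i)
  g-inj : Injective _≡_ _≡_ g
  g-inj eq = suc-injective (f-inj (punchOut-injective (f₀≢f₊ _) (f₀≢f₊ _) eq))
  g∈X : ∀ i → g i ∈ X ∘ punchIn (f zero)
  g∈X i = x∈X∘f⁺ (subst (_∈ X) (sym (punchIn-punchOut (f₀≢f₊ i))) (f∈X (suc i)))

x∈X∩Y⁺ : ∀ {x} → x ∈ X → x ∈ Y → x ∈ X ∩ Y
x∈X∩Y⁺ (mk∈ x∈X) (mk∈ x∈Y) = mk∈ (Equivalence.from T-∧ (x∈X , x∈Y))

x∈X∩Y⁻ : ∀ {x} → x ∈ X ∩ Y → x ∈ X × x ∈ Y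
x∈X∩Y⁻ (mk∈ x∈X∩Y) = Data.Product.map mk∈ mk∈ (Equivalence.to T-∧ x∈X∩Y)

x∈X∪Y⁺ : ∀ {x} → x ∈ X ⊎ x ∈ Y → x ∈ X ∪ Y
x∈X∪Y⁺ x∈X⊎x∈Y = mk∈ (Equivalence.from T-∨ (Data.Sum.map ∈⇒T ∈⇒T x∈X⊎x∈Y))

x∈X∪Y⁻ : ∀ {x} → x ∈ X ∪ Y → x ∈ X ⊎ x ∈ Y
x∈X∪Y⁻ (mk∈ x∈X∪Y) = Data.Sum.map mk∈ mk∈ (Equivalence.to T-∨ x∈X∪Y)

x∈∁X⁺ : ∀ {x} → x ∉ X → x ∈ ∁ X
x∈∁X⁺ x∉X = mk∈ (¬T⇒T-not (x∉X ∘ mk∈))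
  where
  ¬T⇒T-not : ∀ {b} → ¬ T b → T (not b)
  ¬T⇒T-not {false} _  = _
  ¬T⇒T-not {true}  ¬T = contradiction _ ¬T

x∈∁X⁻ : ∀ {x} → x ∈ ∁ X → x ∉ X
x∈∁X⁻ (mk∈ x∈∁X) (mk∈ x∈X) = T-not⇒¬T x∈∁X x∈X
  where
  T-not⇒¬T : ∀ {b} → T (not b) → ¬ T b
  T-not⇒¬T {false} _ ()

x∈⁅x⁆ : ∀ (x : Fin n) → x ∈ ⁅ x ⁆
x∈⁅x⁆ x = mk∈ (fromWitness refl)

x∈⁅y⁆⇒x≡y : ∀ {x y : Fin n} → x ∈ ⁅ y ⁆ → x ≡ y
x∈⁅y⁆⇒x≡y = toWitness ∘ ∈⇒T

-- Sumsets and erosions in a finite abelian group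

module Sumsets {a : ℕ} {_·_ : Op₂ (Fin a)} {e : Fin a} {inv : Op₁ (Fin a)}
         (isAbelianGroup : IsAbelianGroup _≡_ _·_ e inv) where

  private
    G : AbelianGroup 0ℓ 0ℓ
    G = record { isAbelianGroup = isAbelianGroup }

  open AbelianGroup G using (_∙_; ε; _⁻¹; assoc; comm; identityʳ)
  open import Algebra.Properties.AbelianGroup G

  x∙y⁻¹∙y≡x : ∀ x y → x ∙ y ⁻¹ ∙ y ≡ x
  x∙y⁻¹∙y≡x x y = //-rightDividesˡ y x

  x∙y∙y⁻¹≡x : ∀ x y → x ∙ y ∙ y ⁻¹ ≡ x
  x∙y∙y⁻¹≡x x y = //-rightDividesʳ y x

  x∙y∙x⁻¹≡y : ∀ x y → x ∙ y ∙ x ⁻¹ ≡ y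
  x∙y∙x⁻¹≡y = xyx⁻¹≈y

  x∙y∙z≡x∙z∙y : ∀ x y z → x ∙ y ∙ z ≡ x ∙ z ∙ y
  x∙y∙z≡x∙z∙y x y z = begin
    x ∙ y ∙ z   ≡⟨ assoc x y z ⟩
    x ∙ (y ∙ z) ≡⟨ cong (x ∙_) (comm y z) ⟩
    x ∙ (z ∙ y) ≡⟨ assoc x z y ⟨
    x ∙ z ∙ y   ∎
    where open ≡-Reasoning

  [x∙y⁻¹]⁻¹≡x⁻¹∙y : ∀ x y → (x ∙ y ⁻¹) ⁻¹ ≡ x ⁻¹ ∙ y
  [x∙y⁻¹]⁻¹≡x⁻¹∙y x y = trans (sym (⁻¹-∙-comm x (y ⁻¹))) (cong (x ⁻¹ ∙_) (⁻¹-involutive y))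

  [x∙y]⁻¹≡x⁻¹∙y⁻¹ : ∀ x y → (x ∙ y) ⁻¹ ≡ x ⁻¹ ∙ y ⁻¹
  [x∙y]⁻¹≡x⁻¹∙y⁻¹ x y = sym (⁻¹-∙-comm x y)

  x∙ε⁻¹≡x : ∀ x → x ∙ ε ⁻¹ ≡ x
  x∙ε⁻¹≡x x = trans (cong (x ∙_) ε⁻¹≈ε) (identityʳ x)

  infixl 8 _⊕_ _⊖_

  _⊕_ _⊖_ : ∀ {k} → Subset a → (Fin k → Fin a) → Subset a
  (X ⊕ B) y = ⌊ any? (λ i → y ∙ B i ⁻¹ ∈? X) ⌋
  (X ⊖ B) x = ⌊ all? (λ i → x ∙ B i ∈? X) ⌋

  shift : Fin a → Subset a → Subset a
  shift t X z = X (z ∙ t)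

  mirror : Subset a → Subset a
  mirror X = ∁ X ∘ _⁻¹

  Proper : Subset a → Set
  Proper X = (∃ λ x → x ∈ X) × (∃ λ y → y ∉ X)

  module _ {k : ℕ} {B : Fin k → Fin a} {X : Subset a} where

    x∈X⊕B⁺ : ∀ {y} i → y ∙ B i ⁻¹ ∈ X → y ∈ X ⊕ B
    x∈X⊕B⁺ i y∙b⁻¹∈X = mk∈ (fromWitness (i , y∙b⁻¹∈X))

    x∈X⊕B⁻ : ∀ {y} → y ∈ X ⊕ B → ∃ λ i → y ∙ B i ⁻¹ ∈ X
    x∈X⊕B⁻ = toWitness ∘ ∈⇒T

    x∈X⊖B⁺ : ∀ {x} → (∀ i → x ∙ B i ∈ X) → x ∈ X ⊖ B
    x∈X⊖B⁺ = mk∈ ∘ fromWitness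

    x∈X⊖B⁻ : ∀ {x} → x ∈ X ⊖ B → ∀ i → x ∙ B i ∈ X
    x∈X⊖B⁻ = toWitness ∘ ∈⇒T

  module _ {k : ℕ} (B : Fin k → Fin a) where

    -- In a finite group this says that B generates the group.
    Generates : Set
    Generates = ∀ {X} → (∀ {x} i → x ∈ X → x ∙ B i ∈ X) → ∀ {x} → x ∈ X → ∀ y → y ∈ X

    ⊕-∩ : ∀ {X Y} → (X ∩ Y) ⊕ B ⊆ X ⊕ B ∩ Y ⊕ B
    ⊕-∩ {X} {Y} z∈ with i , z∙b⁻¹∈X∩Y ← x∈X⊕B⁻ z∈ =
      let z∙b⁻¹∈X , z∙b⁻¹∈Y = x∈X∩Y⁻ z∙b⁻¹∈X∩Y
      in x∈X∩Y⁺ (x∈X⊕B⁺ i z∙b⁻¹∈X) (x∈X⊕B⁺ i z∙b⁻¹∈Y)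

    ⊕-∪ : ∀ {X Y} → (X ∪ Y) ⊕ B ⊆ X ⊕ B ∪ Y ⊕ B
    ⊕-∪ {X} {Y} z∈ with i , z∙b⁻¹∈X∪Y ← x∈X⊕B⁻ z∈
                   with x∈X∪Y⁻ z∙b⁻¹∈X∪Y
    ... | inj₁ z∙b⁻¹∈X = x∈X∪Y⁺ (inj₁ (x∈X⊕B⁺ i z∙b⁻¹∈X))
    ... | inj₂ z∙b⁻¹∈Y = x∈X∪Y⁺ (inj₂ (x∈X⊕B⁺ i z∙b⁻¹∈Y))

    ⊖-∩ : ∀ {X Y} → X ⊖ B ∩ Y ⊖ B ⊆ (X ∩ Y) ⊖ B
    ⊖-∩ {X} {Y} z∈ =
      let z∈X⊖B , z∈Y⊖B = x∈X∩Y⁻ z∈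
      in x∈X⊖B⁺ λ i → x∈X∩Y⁺ (x∈X⊖B⁻ z∈X⊖B i) (x∈X⊖B⁻ z∈Y⊖B i)

    ⊖-∪ : ∀ {X Y} → X ⊖ B ∪ Y ⊖ B ⊆ (X ∪ Y) ⊖ B
    ⊖-∪ {X} {Y} z∈ with x∈X∪Y⁻ z∈
    ... | inj₁ z∈X⊖B = x∈X⊖B⁺ λ i → x∈X∪Y⁺ (inj₁ (x∈X⊖B⁻ z∈X⊖B i))
    ... | inj₂ z∈Y⊖B = x∈X⊖B⁺ λ i → x∈X∪Y⁺ (inj₂ (x∈X⊖B⁻ z∈Y⊖B i))

    ∣shift∣ : ∀ t X → ∣ shift t X ∣ ≡ ∣ X ∣
    ∣shift∣ t X = ∣∣-∘-inverse X (λ z → x∙y⁻¹∙y≡x z t) (λ z → x∙y∙y⁻¹≡x z t)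

    ∣shift⊕∣ : ∀ t X → ∣ shift t X ⊕ B ∣ ≡ ∣ X ⊕ B ∣
    ∣shift⊕∣ t X = trans (∣∣-cong shift⊕⊆ ⊆shift⊕) (∣shift∣ t (X ⊕ B))
      where
      shift⊕⊆ : shift t X ⊕ B ⊆ shift t (X ⊕ B)
      shift⊕⊆ {z} z∈ with i , z∙b⁻¹∙t∈X ← x∈X⊕B⁻ z∈ =
        x∈X∘f⁺ (x∈X⊕B⁺ i (subst (_∈ X) (x∙y∙z≡x∙z∙y z (B i ⁻¹) t) (x∈X∘f⁻ z∙b⁻¹∙t∈X)))
      ⊆shift⊕ : shift t (X ⊕ B) ⊆ shift t X ⊕ B
      ⊆shift⊕ {z} z∈ with i , z∙t∙b⁻¹∈X ← x∈X⊕B⁻ (x∈X∘f⁻ z∈) =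
        x∈X⊕B⁺ i (x∈X∘f⁺ (subst (_∈ X) (x∙y∙z≡x∙z∙y z t (B i ⁻¹)) z∙t∙b⁻¹∈X))

    ∣shift⊖∣ : ∀ t X → ∣ shift t X ⊖ B ∣ ≡ ∣ X ⊖ B ∣
    ∣shift⊖∣ t X = trans (∣∣-cong shift⊖⊆ ⊆shift⊖) (∣shift∣ t (X ⊖ B))
      where
      shift⊖⊆ : shift t X ⊖ B ⊆ shift t (X ⊖ B)
      shift⊖⊆ {z} z∈ = x∈X∘f⁺ (x∈X⊖B⁺ λ i →
        subst (_∈ X) (x∙y∙z≡x∙z∙y z (B i) t) (x∈X∘f⁻ (x∈X⊖B⁻ z∈ i)))
      ⊆shift⊖ : shift t (X ⊖ B) ⊆ shift t X ⊖ B
      ⊆shift⊖ {z} z∈ = x∈X⊖B⁺ λ i →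
        x∈X∘f⁺ (subst (_∈ X) (x∙y∙z≡x∙z∙y z t (B i)) (x∈X⊖B⁻ (x∈X∘f⁻ z∈) i))

    ∣mirror∣+∣∣ : ∀ X → ∣ mirror X ∣ + ∣ X ∣ ≡ a
    ∣mirror∣+∣∣ X =
      trans (cong (_+ ∣ X ∣) (∣∣-∘-inverse (∁ X) ⁻¹-involutive ⁻¹-involutive)) (∣∁∣+∣∣ X)

    module _ {X : Subset a} {z : Fin a} where

      x∈mirrorX⁺ : z ⁻¹ ∉ X → z ∈ mirror X
      x∈mirrorX⁺ = x∈X∘f⁺ ∘ x∈∁X⁺

      x∈mirrorX⁻ : z ∈ mirror X → z ⁻¹ ∉ X
      x∈mirrorX⁻ = x∈∁X⁻ ∘ x∈X∘f⁻

    mirror-proper : ∀ {X} → Proper X → Proper (mirror X)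
    mirror-proper {X} ((x , x∈X) , (y , y∉X)) =
      (y ⁻¹ , x∈mirrorX⁺ (y∉X ∘ subst (_∈ X) (⁻¹-involutive y))) ,
      (x ⁻¹ , λ x⁻¹∈ → x∈mirrorX⁻ x⁻¹∈ (subst (_∈ X) (sym (⁻¹-involutive x)) x∈X))

    ∣mirror⊕∣+∣⊖∣ : ∀ X → ∣ mirror X ⊕ B ∣ + ∣ X ⊖ B ∣ ≡ a
    ∣mirror⊕∣+∣⊖∣ X =
      trans (cong (_+ ∣ X ⊖ B ∣) (∣∣-cong mirror⊕⊆ ⊆mirror⊕)) (∣mirror∣+∣∣ (X ⊖ B))
      where
      mirror⊕⊆ : mirror X ⊕ B ⊆ mirror (X ⊖ B)
      mirror⊕⊆ {z} z∈ with i , z∙b⁻¹∈ ← x∈X⊕B⁻ z∈ = x∈mirrorX⁺ λ z⁻¹∈X⊖B →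
        x∈mirrorX⁻ z∙b⁻¹∈ (subst (_∈ X) (sym ([x∙y⁻¹]⁻¹≡x⁻¹∙y z (B i))) (x∈X⊖B⁻ z⁻¹∈X⊖B i))
      ⊆mirror⊕ : mirror (X ⊖ B) ⊆ mirror X ⊕ B
      ⊆mirror⊕ {z} z∈
        with i , z⁻¹∙b∉X ← ¬∀⟶∃¬ k _ (λ i → z ⁻¹ ∙ B i ∈? X) (x∈mirrorX⁻ z∈ ∘ x∈X⊖B⁺) =
        x∈X⊕B⁺ i (x∈mirrorX⁺ (z⁻¹∙b∉X ∘ subst (_∈ X) ([x∙y⁻¹]⁻¹≡x⁻¹∙y z (B i))))

    ∣mirror⊖∣+∣⊕∣ : ∀ X → ∣ mirror X ⊖ B ∣ + ∣ X ⊕ B ∣ ≡ a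
    ∣mirror⊖∣+∣⊕∣ X =
      trans (cong (_+ ∣ X ⊕ B ∣) (∣∣-cong mirror⊖⊆ ⊆mirror⊖)) (∣mirror∣+∣∣ (X ⊕ B))
      where
      mirror⊖⊆ : mirror X ⊖ B ⊆ mirror (X ⊕ B)
      mirror⊖⊆ {z} z∈ = x∈mirrorX⁺ λ z⁻¹∈X⊕B → let i , z⁻¹∙b⁻¹∈X = x∈X⊕B⁻ z⁻¹∈X⊕B in
        x∈mirrorX⁻ (x∈X⊖B⁻ z∈ i) (subst (_∈ X) (sym ([x∙y]⁻¹≡x⁻¹∙y⁻¹ z (B i))) z⁻¹∙b⁻¹∈X)
      ⊆mirror⊖ : mirror (X ⊕ B) ⊆ mirror X ⊖ B
      ⊆mirror⊖ {z} z∈ = x∈X⊖B⁺ λ i → x∈mirrorX⁺ λ [z∙b]⁻¹∈X →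
        x∈mirrorX⁻ z∈ (x∈X⊕B⁺ i (subst (_∈ X) ([x∙y]⁻¹≡x⁻¹∙y⁻¹ z (B i)) [z∙b]⁻¹∈X))

    module Erosion (ε∈B : ∃ λ i → B i ≡ ε) (B-injective : Injective _≡_ _≡_ B) (B-generates : Generates) where

      X⊖B⊆X : ∀ {X} → X ⊖ B ⊆ X
      X⊖B⊆X {X} {z} z∈ = let i , Bi≡ε = ε∈B in
        subst (_∈ X) (trans (cong (z ∙_) Bi≡ε) (identityʳ z)) (x∈X⊖B⁻ z∈ i)

      X⊆X⊕B : ∀ {X} → X ⊆ X ⊕ B
      X⊆X⊕B {X} {z} z∈ = let i , Bi≡ε = ε∈B in
        x∈X⊕B⁺ i (subst (_∈ X) (sym (trans (cong (λ b → z ∙ b ⁻¹) Bi≡ε) (x∙ε⁻¹≡x z))) z∈)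

      gap : Subset a → ℕ
      gap X = ∣ X ⊕ B ∣ ∸ ∣ X ⊖ B ∣

      gap+∣⊖∣ : ∀ X → gap X + ∣ X ⊖ B ∣ ≡ ∣ X ⊕ B ∣
      gap+∣⊖∣ X = m∸n+n≡m (∣∣-mono (X⊆X⊕B ∘ X⊖B⊆X))

      gap-shift : ∀ t X → gap (shift t X) ≡ gap X
      gap-shift t X = cong₂ _∸_ (∣shift⊕∣ t X) (∣shift⊖∣ t X)

      gap-mirror : ∀ X → gap (mirror X) ≡ gap X
      gap-mirror X = m+n≡o+p⇒m∸o≡p∸n _ (∣ X ⊖ B ∣) _ (∣ X ⊕ B ∣)
                       (trans (∣mirror⊕∣+∣⊖∣ X) (sym (∣mirror⊖∣+∣⊕∣ X)))
        where
        m+n≡o+p⇒m∸o≡p∸n : ∀ m n o p → m + n ≡ o + p → m ∸ o ≡ p ∸ n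
        m+n≡o+p⇒m∸o≡p∸n m n o p eq = begin
          m ∸ o             ≡⟨ [m+n]∸[m+o]≡n∸o n m o ⟨
          (n + m) ∸ (n + o) ≡⟨ cong₂ _∸_ (trans (+-comm n m) eq) (+-comm n o) ⟩
          (o + p) ∸ (o + n) ≡⟨ [m+n]∸[m+o]≡n∸o o p n ⟩
          p ∸ n             ∎
          where open ≡-Reasoning

      gap-submodular : ∀ X Y → gap (X ∩ Y) + gap (X ∪ Y) ≤ gap X + gap Y
      gap-submodular X Y = +-cancelʳ-≤ (∣ (X ∩ Y) ⊖ B ∣ + ∣ (X ∪ Y) ⊖ B ∣) _ _ (begin
        gap (X ∩ Y) + gap (X ∪ Y) + (∣ (X ∩ Y) ⊖ B ∣ + ∣ (X ∪ Y) ⊖ B ∣)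
          ≡⟨ interchange (gap (X ∩ Y)) (gap (X ∪ Y)) _ _ ⟩
        (gap (X ∩ Y) + ∣ (X ∩ Y) ⊖ B ∣) + (gap (X ∪ Y) + ∣ (X ∪ Y) ⊖ B ∣)
          ≡⟨ cong₂ _+_ (gap+∣⊖∣ (X ∩ Y)) (gap+∣⊖∣ (X ∪ Y)) ⟩
        ∣ (X ∩ Y) ⊕ B ∣ + ∣ (X ∪ Y) ⊕ B ∣
          ≤⟨ ∣∣-+-≤-∩∪ ⊕-∩ ⊕-∪ ⟩
        ∣ X ⊕ B ∣ + ∣ Y ⊕ B ∣
          ≡⟨ cong₂ _+_ (gap+∣⊖∣ X) (gap+∣⊖∣ Y) ⟨
        (gap X + ∣ X ⊖ B ∣) + (gap Y + ∣ Y ⊖ B ∣)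
          ≡⟨ interchange (gap X) ∣ X ⊖ B ∣ _ _ ⟩
        gap X + gap Y + (∣ X ⊖ B ∣ + ∣ Y ⊖ B ∣)
          ≤⟨ +-monoʳ-≤ (gap X + gap Y) (∣∣-+-≥-∩∪ ⊖-∩ ⊖-∪) ⟩
        gap X + gap Y + (∣ (X ∩ Y) ⊖ B ∣ + ∣ (X ∪ Y) ⊖ B ∣) ∎)
        where open ≤-Reasoning

      k≤∣⊕∣ : ∀ {X x} → x ∈ X → k ≤ ∣ X ⊕ B ∣
      k≤∣⊕∣ {X} {x} x∈X = injective⇒≤∣∣ (X ⊕ B) ((x ∙_) ∘ B) (B-injective ∘ ∙-cancelˡ x _ _)
        λ i → x∈X⊕B⁺ i (subst (_∈ X) (sym (x∙y∙y⁻¹≡x x (B i))) x∈X)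

      module Extremal {X : Subset a} (X-proper : Proper X)
        (gap-minimal  : ∀ {Y} → Proper Y → gap X ≤ gap Y)
        (size-minimal : ∀ {Y} → Proper Y → gap Y ≤ gap X → ∣ X ∣ ≤ ∣ Y ∣) where

        y₀ : Fin a
        y₀ = proj₁ (proj₂ X-proper)

        ∣X∣+∣X∣≤a : ∣ X ∣ + ∣ X ∣ ≤ a
        ∣X∣+∣X∣≤a = begin
          ∣ X ∣ + ∣ X ∣        ≤⟨ +-monoʳ-≤ ∣ X ∣ ∣X∣≤∣mirrorX∣ ⟩
          ∣ X ∣ + ∣ mirror X ∣ ≡⟨ +-comm ∣ X ∣ _ ⟩
          ∣ mirror X ∣ + ∣ X ∣ ≡⟨ ∣mirror∣+∣∣ X ⟩
          a                    ∎
          where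
          open ≤-Reasoning
          ∣X∣≤∣mirrorX∣ : ∣ X ∣ ≤ ∣ mirror X ∣
          ∣X∣≤∣mirrorX∣ = size-minimal (mirror-proper X-proper) (≤-reflexive (gap-mirror X))

        -- With t = x − y, U = X ∪ (X − t) is proper as 2∣X∣ ≤ a, so submodularity and gap-minimality
        -- give gap (X ∩ (X − t)) ≤ gap X, and then size-minimality forces X ⊆ X − t.
        shift-closed : ∀ {x y z} → x ∈ X → y ∈ X → z ∈ X → z ∙ (x ∙ y ⁻¹) ∈ X
        shift-closed {x} {y} x∈X y∈X = x∈X∘f⁻ ∘ proj₂ ∘ x∈X∩Y⁻ ∘ X⊆I
          where
          Xₜ I U : Subset a
          Xₜ = shift (x ∙ y ⁻¹) X
          I  = X ∩ Xₜ
          U  = X ∪ Xₜ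

          y∈I : y ∈ I
          y∈I = x∈X∩Y⁺ y∈X (x∈X∘f⁺ (subst (_∈ X) x≡y∙[x∙y⁻¹] x∈X))
            where
            x≡y∙[x∙y⁻¹] : x ≡ y ∙ (x ∙ y ⁻¹)
            x≡y∙[x∙y⁻¹] = sym (trans (sym (assoc y x (y ⁻¹))) (x∙y∙x⁻¹≡y y x))

          I-proper : Proper I
          I-proper = (y , y∈I) , (y₀ , proj₂ (proj₂ X-proper) ∘ proj₁ ∘ x∈X∩Y⁻)

          ∣U∣<a : ∣ U ∣ < a
          ∣U∣<a = begin-strict
            ∣ U ∣             ≡⟨ +-identityʳ ∣ U ∣ ⟨
            ∣ U ∣ + 0         <⟨ +-monoʳ-< ∣ U ∣ (∈⇒0<∣∣ y∈I) ⟩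
            ∣ U ∣ + ∣ I ∣     ≡⟨ ∣∪∣+∣∩∣ X Xₜ ⟩
            ∣ X ∣ + ∣ Xₜ ∣     ≡⟨ cong (∣ X ∣ +_) (∣shift∣ (x ∙ y ⁻¹) X) ⟩
            ∣ X ∣ + ∣ X ∣     ≤⟨ ∣X∣+∣X∣≤a ⟩
            a                 ∎
            where open ≤-Reasoning

          U-proper : Proper U
          U-proper = (x , x∈X∪Y⁺ (inj₁ x∈X)) , ∣∣<n⇒∃∉ ∣U∣<a

          gap-I≤gap-X : gap I ≤ gap X
          gap-I≤gap-X = +-cancelʳ-≤ (gap X) _ _ (begin
            gap I + gap X  ≤⟨ +-monoʳ-≤ (gap I) (gap-minimal U-proper) ⟩
            gap I + gap U  ≤⟨ gap-submodular X Xₜ ⟩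
            gap X + gap Xₜ ≡⟨ cong (gap X +_) (gap-shift (x ∙ y ⁻¹) X) ⟩
            gap X + gap X  ∎)
            where open ≤-Reasoning

          X⊆I : X ⊆ I
          X⊆I = ⊆∧∣∣≤⇒⊇ (proj₁ ∘ x∈X∩Y⁻) (size-minimal I-proper gap-I≤gap-X)

        X⊖B-empty : ∀ z → z ∉ X ⊖ B
        X⊖B-empty z z∈X⊖B = proj₂ (proj₂ X-proper) (B-generates B-closed (proj₂ (proj₁ X-proper)) y₀)
          where
          B-closed : ∀ {w} i → w ∈ X → w ∙ B i ∈ X
          B-closed {w} i = subst (_∈ X) (cong (w ∙_) (x∙y∙x⁻¹≡y z (B i)))
            ∘ shift-closed (x∈X⊖B⁻ z∈X⊖B i) (X⊖B⊆X z∈X⊖B)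

        k≤gap : k ≤ gap X
        k≤gap = subst (k ≤_) (cong (∣ X ⊕ B ∣ ∸_) (sym (empty⇒∣∣≡0 X⊖B-empty)))
                      (k≤∣⊕∣ (proj₂ (proj₁ X-proper)))

      erosion-bound : ∀ {X} → Proper X → k + ∣ X ⊖ B ∣ ≤ ∣ X ⊕ B ∣
      erosion-bound {X} X-proper =
        subst (k + ∣ X ⊖ B ∣ ≤_) (gap+∣⊖∣ X) (+-monoˡ-≤ ∣ X ⊖ B ∣ (k≤gap X X-proper))
        where
        -- Ordering sets by gap and then by size, a minimal counterexample would be extremal.
        μ : Subset a → ℕ
        μ Y = gap Y * suc a + ∣ Y ∣

        μ-<-gap : ∀ {X Y} → gap Y < gap X → μ Y < μ X
        μ-<-gap {X} {Y} gapY<gapX = begin-strict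
          gap Y * suc a + ∣ Y ∣   <⟨ +-monoʳ-< (gap Y * suc a) (s≤s (∣∣≤n Y)) ⟩
          gap Y * suc a + suc a   ≡⟨ +-comm (gap Y * suc a) (suc a) ⟩
          suc (gap Y) * suc a     ≤⟨ *-monoˡ-≤ (suc a) gapY<gapX ⟩
          gap X * suc a           ≤⟨ m≤m+n (gap X * suc a) ∣ X ∣ ⟩
          μ X                     ∎
          where open ≤-Reasoning

        μ-<-size : ∀ {X Y} → gap Y ≤ gap X → ∣ Y ∣ < ∣ X ∣ → μ Y < μ X
        μ-<-size gapY≤gapX = +-mono-≤-< (*-monoˡ-≤ (suc a) gapY≤gapX)

        k≤gap : ∀ X → Proper X → k ≤ gap X
        k≤gap = All.wfRec (On.wellFounded μ <-wellFounded) 0ℓ _ step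
          where
          step : ∀ X → (∀ {Y} → μ Y < μ X → Proper Y → k ≤ gap Y) → Proper X → k ≤ gap X
          step X IH X-proper with k ≤? gap X
          ... | yes k≤gapX = k≤gapX
          ... | no  k≰gapX = Extremal.k≤gap X-proper gap-minimal size-minimal
            where
            gapX<k : gap X < k
            gapX<k = ≰⇒> k≰gapX
            gap-minimal : ∀ {Y} → Proper Y → gap X ≤ gap Y
            gap-minimal Y-proper = ≮⇒≥ λ gapY<gapX →
              <⇒≱ gapX<k (≤-trans (IH (μ-<-gap gapY<gapX) Y-proper) (<⇒≤ gapY<gapX))
            size-minimal : ∀ {Y} → Proper Y → gap Y ≤ gap X → ∣ X ∣ ≤ ∣ Y ∣
            size-minimal Y-proper gapY≤gapX = ≮⇒≥ λ ∣Y∣<∣X∣ →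
              <⇒≱ gapX<k (≤-trans (IH (μ-<-size gapY≤gapX ∣Y∣<∣X∣) Y-proper) gapY≤gapX)

      infix 9 _·B

      _·B : ℕ → Subset a
      zero  ·B = ⁅ ε ⁆
      suc h ·B = h ·B ⊕ B

      ε∈h·B : ∀ h → ε ∈ h ·B
      ε∈h·B zero    = x∈⁅x⁆ ε
      ε∈h·B (suc h) = X⊆X⊕B (ε∈h·B h)

      h·B⊆[1+h]·B⊖B : ∀ h → h ·B ⊆ suc h ·B ⊖ B
      h·B⊆[1+h]·B⊖B h {x} x∈h·B =
        x∈X⊖B⁺ λ i → x∈X⊕B⁺ i (subst (_∈ h ·B) (sym (x∙y∙y⁻¹≡x x (B i))) x∈h·B)

      ∣·B∣-growth : ∀ t → (∃ λ y → y ∉ (t + t) ·B) → suc t * k ≤ ∣ suc (t + t) ·B ∣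
      ∣·B∣-growth zero (y , y∉0·B) = begin
        k + 0                      ≡⟨ +-identityʳ k ⟩
        k                          ≤⟨ m≤m+n k ∣ 0 ·B ⊖ B ∣ ⟩
        k + ∣ 0 ·B ⊖ B ∣           ≤⟨ erosion-bound ((ε , ε∈h·B 0) , (y , y∉0·B)) ⟩
        ∣ 1 ·B ∣                   ∎
        where open ≤-Reasoning
      ∣·B∣-growth (suc t) (y , y∉[1+t+1+t]·B) = begin
        k + suc t * k              ≤⟨ +-monoʳ-≤ k (∣·B∣-growth t (y , y∉ ∘ X⊆X⊕B ∘ X⊆X⊕B)) ⟩
        k + ∣ suc (t + t) ·B ∣     ≤⟨ +-monoʳ-≤ k (∣∣-mono (h·B⊆[1+h]·B⊖B (suc (t + t)))) ⟩
        k + ∣ 2t+2 ·B ⊖ B ∣        ≤⟨ erosion-bound ((ε , ε∈h·B 2t+2) , (y , y∉)) ⟩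
        ∣ suc 2t+2 ·B ∣            ≡⟨ cong (λ h → ∣ suc h ·B ∣) [1+t]+[1+t]≡2t+2 ⟨
        ∣ suc (suc t + suc t) ·B ∣ ∎
        where
        open ≤-Reasoning
        2t+2 : ℕ
        2t+2 = suc (suc (t + t))
        [1+t]+[1+t]≡2t+2 : suc t + suc t ≡ 2t+2
        [1+t]+[1+t]≡2t+2 = cong suc (+-suc t t)
        y∉ : y ∉ 2t+2 ·B
        y∉ = subst (λ h → y ∉ h ·B) [1+t]+[1+t]≡2t+2 y∉[1+t+1+t]·B

      ·B-full : ∀ j → a < suc j * k → ∀ z → z ∈ (j + j) ·B
      ·B-full j a<[1+j]k z with z ∈? (j + j) ·B
      ... | yes z∈ = z∈
      ... | no  z∉ = contradiction (≤-trans (∣·B∣-growth j (z , z∉)) (∣∣≤n _)) (<⇒≱ a<[1+j]k)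

-- The cyclic group ℤ/Aℤ

module AdditivelyClosed {Q : ℕ → Set} (Q-0 : Q 0) (Q-+ : ∀ {m n} → Q m → Q n → Q (m + n)) where

  Q-* : ∀ c {n} → Q n → Q (c * n)
  Q-* zero    Qn = Q-0
  Q-* (suc c) Qn = Q-+ Qn (Q-* c Qn)

  module _ (Q-∸ : ∀ {m n} → Q (m + n) → Q n → Q m) where

    Q-gcd : ∀ {m n} → Q m → Q n → Q (gcd m n)
    Q-gcd {m} {n} Qm Qn with Bézout.identity (gcd-GCD m n)
    ... | Bézout.+- x y eq = Q-∸ (subst Q (sym eq) (Q-* x Qm)) (Q-* y Qn)
    ... | Bézout.-+ x y eq = Q-∸ (subst Q (sym eq) (Q-* y Qn)) (Q-* x Qm)

    Q-gcdAll : ∀ {k} (w : Vector ℕ k) → (∀ i → Q (w i)) → Q (gcdAll w)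
    Q-gcdAll {zero}  w Qw = Q-0
    Q-gcdAll {suc k} w Qw = Q-gcd (Qw zero) (Q-gcdAll (w ∘ suc) (Qw ∘ suc))

module ℤ/ (A : ℕ) .{{A≢0 : NonZero A}} where

  infixl 6 _+ₘ_
  infix  8 -ₘ_

  ι : ℕ → Fin A
  ι m = m mod A

  _+ₘ_ : Fin A → Fin A → Fin A
  x +ₘ y = ι (toℕ x + toℕ y)

  -ₘ_ : Fin A → Fin A
  -ₘ x = ι (A ∸ toℕ x)

  0ₘ : Fin A
  0ₘ = ι 0

  toℕ-ι : ∀ m → toℕ (ι m) ≡ m % A
  toℕ-ι m = toℕ-fromℕ< (m%n<n m A)

  ι-toℕ : ∀ x → ι (toℕ x) ≡ x
  ι-toℕ x = toℕ-injective (trans (toℕ-ι (toℕ x)) (m<n⇒m%n≡m (toℕ<n x)))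

  toℕ-0ₘ : toℕ 0ₘ ≡ 0
  toℕ-0ₘ = trans (toℕ-ι 0) (m<n⇒m%n≡m (>-nonZero⁻¹ A))

  ι-+ : ∀ m n → ι (m + n) ≡ ι m +ₘ ι n
  ι-+ m n = toℕ-injective (begin
    toℕ (ι (m + n))                 ≡⟨ toℕ-ι (m + n) ⟩
    (m + n) % A                     ≡⟨ %-distribˡ-+ m n A ⟩
    (m % A + n % A) % A             ≡⟨ cong₂ (λ i j → (i + j) % A) (toℕ-ι m) (toℕ-ι n) ⟨
    (toℕ (ι m) + toℕ (ι n)) % A     ≡⟨ toℕ-ι _ ⟨
    toℕ (ι m +ₘ ι n)                ∎)
    where open ≡-Reasoning

  ι-A≡0ₘ : ι A ≡ 0ₘ
  ι-A≡0ₘ = toℕ-injective (trans (toℕ-ι A) (trans (n%n≡0 A) (sym toℕ-0ₘ)))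

  +ₘ-comm : ∀ x y → x +ₘ y ≡ y +ₘ x
  +ₘ-comm x y = cong ι (+-comm (toℕ x) (toℕ y))

  +ₘ-assoc : ∀ x y z → (x +ₘ y) +ₘ z ≡ x +ₘ (y +ₘ z)
  +ₘ-assoc x y z = begin
    (x +ₘ y) +ₘ z                       ≡⟨ cong ((x +ₘ y) +ₘ_) (ι-toℕ z) ⟨
    ι (toℕ x + toℕ y) +ₘ ι (toℕ z)      ≡⟨ ι-+ (toℕ x + toℕ y) (toℕ z) ⟨
    ι (toℕ x + toℕ y + toℕ z)           ≡⟨ cong ι (+-assoc (toℕ x) (toℕ y) (toℕ z)) ⟩
    ι (toℕ x + (toℕ y + toℕ z))         ≡⟨ ι-+ (toℕ x) (toℕ y + toℕ z) ⟩
    ι (toℕ x) +ₘ (y +ₘ z)               ≡⟨ cong (_+ₘ (y +ₘ z)) (ι-toℕ x) ⟩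
    x +ₘ (y +ₘ z)                       ∎
    where open ≡-Reasoning

  +ₘ-identityʳ : ∀ x → x +ₘ 0ₘ ≡ x
  +ₘ-identityʳ x = trans (cong (λ i → ι (toℕ x + i)) toℕ-0ₘ) (trans (cong ι (+-identityʳ (toℕ x))) (ι-toℕ x))

  +ₘ-inverseʳ : ∀ x → x +ₘ -ₘ x ≡ 0ₘ
  +ₘ-inverseʳ x = begin
    x +ₘ ι (A ∸ toℕ x)            ≡⟨ cong (_+ₘ ι (A ∸ toℕ x)) (ι-toℕ x) ⟨
    ι (toℕ x) +ₘ ι (A ∸ toℕ x)    ≡⟨ ι-+ (toℕ x) (A ∸ toℕ x) ⟨
    ι (toℕ x + (A ∸ toℕ x))       ≡⟨ cong ι (m+[n∸m]≡n (<⇒≤ (toℕ<n x))) ⟩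
    ι A                           ≡⟨ ι-A≡0ₘ ⟩
    0ₘ                            ∎
    where open ≡-Reasoning

  isAbelianGroup : IsAbelianGroup _≡_ _+ₘ_ 0ₘ -ₘ_
  isAbelianGroup = record
    { isGroup = record
      { isMonoid = record
        { isSemigroup = record
          { isMagma = record { isEquivalence = isEquivalence ; ∙-cong = cong₂ _+ₘ_ }
          ; assoc   = +ₘ-assoc
          }
        ; identity = (λ x → trans (+ₘ-comm 0ₘ x) (+ₘ-identityʳ x)) , +ₘ-identityʳ
        }
      ; inverse = (λ x → trans (+ₘ-comm (-ₘ x) x) (+ₘ-inverseʳ x)) , +ₘ-inverseʳ
      ; ⁻¹-cong = cong -ₘ_
      }
    ; comm = +ₘ-comm
    }

  +ₘ-abelianGroup : AbelianGroup 0ℓ 0ℓ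
  +ₘ-abelianGroup = record { isAbelianGroup = isAbelianGroup }

  open import Algebra.Properties.AbelianGroup +ₘ-abelianGroup using (identityˡ-unique)
  open Sumsets isAbelianGroup using (Generates; x∙y⁻¹∙y≡x)

  ι-A*n≡0ₘ : ∀ n → ι (A * n) ≡ 0ₘ
  ι-A*n≡0ₘ n = toℕ-injective (begin
    toℕ (ι (A * n)) ≡⟨ toℕ-ι (A * n) ⟩
    (A * n) % A     ≡⟨ cong (_% A) (*-comm A n) ⟩
    (n * A) % A     ≡⟨ m*n%n≡0 n A ⟩
    0               ≡⟨ toℕ-0ₘ ⟨
    toℕ 0ₘ          ∎)
    where open ≡-Reasoning

  coprime-generates : ∀ {k} (w : Fin k → ℕ) → gcdAll w ≡ 1 → Generates (ι ∘ w)
  coprime-generates w gcd≡1 {X} X-closed {x} x∈X y = subst (_∈ X) x+[y-x]≡y (period (toℕ (y +ₘ -ₘ x)) x∈X)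
    where
    -- The periods contain every w i and are closed under + and, as ι (A * n) = 0ₘ, under −;
    -- by Bézout they contain gcdAll w = 1, hence everything.
    Period : ℕ → Set
    Period n = ∀ {z} → z ∈ X → z +ₘ ι n ∈ X

    period-0 : Period 0
    period-0 {z} = subst (_∈ X) (sym (+ₘ-identityʳ z))

    period-+ : ∀ {m n} → Period m → Period n → Period (m + n)
    period-+ {m} {n} Pm Pn {z} =
      subst (_∈ X) (trans (+ₘ-assoc z (ι m) (ι n)) (cong (z +ₘ_) (sym (ι-+ m n)))) ∘ Pn ∘ Pm

    open AdditivelyClosed {Q = Period} period-0 period-+

    ι[m+n+pred[A]*n]≡ι[m] : ∀ m n → ι (m + n + pred A * n) ≡ ι m
    ι[m+n+pred[A]*n]≡ι[m] m n = begin
      ι (m + n + pred A * n)   ≡⟨ cong ι (+-assoc m n (pred A * n)) ⟩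
      ι (m + suc (pred A) * n) ≡⟨ cong (λ a → ι (m + a * n)) (suc-pred A) ⟩
      ι (m + A * n)            ≡⟨ ι-+ m (A * n) ⟩
      ι m +ₘ ι (A * n)         ≡⟨ cong (ι m +ₘ_) (ι-A*n≡0ₘ n) ⟩
      ι m +ₘ 0ₘ                ≡⟨ +ₘ-identityʳ (ι m) ⟩
      ι m                      ∎
      where open ≡-Reasoning

    period-∸ : ∀ {m n} → Period (m + n) → Period n → Period m
    period-∸ {m} {n} Pm+n Pn {z} z∈X =
      subst (λ t → z +ₘ t ∈ X) (ι[m+n+pred[A]*n]≡ι[m] m n) (period-+ Pm+n (Q-* (pred A) Pn) z∈X)

    period : ∀ n → Period n
    period n =
      subst Period (*-identityʳ n) (Q-* n (subst Period gcd≡1 (Q-gcdAll period-∸ w (λ i → X-closed i))))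

    x+[y-x]≡y : x +ₘ ι (toℕ (y +ₘ -ₘ x)) ≡ y
    x+[y-x]≡y = trans (cong (x +ₘ_) (ι-toℕ _)) (trans (+ₘ-comm x _) (x∙y⁻¹∙y≡x y x))

  ι≡0ₘ∧<A⇒≡0 : ∀ {m} → ι m ≡ 0ₘ → m < A → m ≡ 0
  ι≡0ₘ∧<A⇒≡0 {m} ιm≡0ₘ m<A = begin
    m           ≡⟨ m<n⇒m%n≡m m<A ⟨
    m % A       ≡⟨ toℕ-ι m ⟨
    toℕ (ι m)   ≡⟨ cong toℕ ιm≡0ₘ ⟩
    toℕ 0ₘ      ≡⟨ toℕ-0ₘ ⟩
    0           ∎
    where open ≡-Reasoning

  ι≡0ₘ⇒A∣ : ∀ {m} → ι m ≡ 0ₘ → A ℕ.∣ m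
  ι≡0ₘ⇒A∣ {m} ιm≡0ₘ = ℕ.m%n≡0⇒n∣m m A (trans (sym (toℕ-ι m)) (trans (cong toℕ ιm≡0ₘ) toℕ-0ₘ))

  ι≡ι⇒ι[∸]≡0ₘ : ∀ {m n} → n ≤ m → ι m ≡ ι n → ι (m ∸ n) ≡ 0ₘ
  ι≡ι⇒ι[∸]≡0ₘ {m} {n} n≤m ιm≡ιn = identityˡ-unique (ι (m ∸ n)) (ι n) (begin
    ι (m ∸ n) +ₘ ι n  ≡⟨ ι-+ (m ∸ n) n ⟨
    ι (m ∸ n + n)     ≡⟨ cong ι (m∸n+n≡m n≤m) ⟩
    ι m               ≡⟨ ιm≡ιn ⟩
    ι n               ∎)
    where open ≡-Reasoning

  ι≡ι∧<⇒≡+* : ∀ {r x} → ι r ≡ ι x → r < x + A → ∃ λ t → x ≡ r + t * A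
  ι≡ι∧<⇒≡+* {r} {x} ιr≡ιx r<x+A with r ≤? x
  ... | yes r≤x with ℕ.divides t x∸r≡t*A ← ι≡0ₘ⇒A∣ (ι≡ι⇒ι[∸]≡0ₘ r≤x (sym ιr≡ιx)) =
    t , trans (sym (m+[n∸m]≡n r≤x)) (cong (r +_) x∸r≡t*A)
  ... | no  r≰x = contradiction (m∸n≡0⇒m≤n r∸x≡0) r≰x
    where
    r∸x≡0 : r ∸ x ≡ 0
    r∸x≡0 = ι≡0ₘ∧<A⇒≡0 (ι≡ι⇒ι[∸]≡0ₘ (≰⇒≥ r≰x) ιr≡ιx) (+-cancelʳ-< x (r ∸ x) A (begin-strict
      r ∸ x + x  ≡⟨ m∸n+n≡m (≰⇒≥ r≰x) ⟩
      r          <⟨ r<x+A ⟩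
      x + A      ≡⟨ +-comm x A ⟩
      A + x      ∎))
      where open ≤-Reasoning

-- Linear combinations, gcds and integer bounds

⟨_,_⟩ : Vector ℕ n → Vector ℕ n → ℕ
⟨ c , w ⟩ = sum (λ i → c i * w i)

⟨,⟩-updateAt : ∀ (c w : Vector ℕ n) i t → ⟨ updateAt c i (t +_) , w ⟩ ≡ t * w i + ⟨ c , w ⟩
⟨,⟩-updateAt {suc n} c w zero    t = begin
  (t + c zero) * w zero + ⟨ c ∘ suc , w ∘ suc ⟩
    ≡⟨ cong (_+ ⟨ c ∘ suc , w ∘ suc ⟩) (*-distribʳ-+ (w zero) t (c zero)) ⟩
  t * w zero + c zero * w zero + ⟨ c ∘ suc , w ∘ suc ⟩
    ≡⟨ +-assoc (t * w zero) (c zero * w zero) _ ⟩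
  t * w zero + ⟨ c , w ⟩
    ∎
  where open ≡-Reasoning
⟨,⟩-updateAt {suc n} c w (suc i) t = begin
  c zero * w zero + ⟨ updateAt (c ∘ suc) i (t +_) , w ∘ suc ⟩
    ≡⟨ cong (c zero * w zero +_) (⟨,⟩-updateAt (c ∘ suc) (w ∘ suc) i t) ⟩
  c zero * w zero + (t * w (suc i) + ⟨ c ∘ suc , w ∘ suc ⟩)
    ≡⟨ x∙yz≈y∙xz (c zero * w zero) (t * w (suc i)) _ ⟩
  t * w (suc i) + ⟨ c , w ⟩
    ∎
  where open ≡-Reasoning

⟨,⟩-cong : ∀ (c : Vector ℕ n) {u v} → (∀ i → u i ≡ v i) → ⟨ c , u ⟩ ≡ ⟨ c , v ⟩
⟨,⟩-cong c u≗v = sum-cong-≗ (λ i → cong (c i *_) (u≗v i))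

div≡/ : ∀ a b .{{_ : NonZero b}} → a div b ≡ a / b
div≡/ a (suc b) = refl

decreasing⇒injective : ∀ {f : Fin n → ℕ} → (∀ i j → i F.< j → f j < f i) → Injective _≡_ _≡_ f
decreasing⇒injective {f = f} f-decreasing {i} {j} fi≡fj with <-cmp i j
... | tri< i<j _ _ = contradiction (sym fi≡fj) (<⇒≢ (f-decreasing i j i<j))
... | tri≈ _ i≡j _ = i≡j
... | tri> _ _ j<i = contradiction fi≡fj (<⇒≢ (f-decreasing j i j<i))

gcdAll-∣ : ∀ (v : Vector ℕ n) i → gcdAll v ℕ.∣ v i
gcdAll-∣ v zero    = gcd[m,n]∣m (v zero) (gcdAll (v ∘ suc))
gcdAll-∣ v (suc i) = ℕ.∣-trans (gcd[m,n]∣n (v zero) (gcdAll (v ∘ suc))) (gcdAll-∣ (v ∘ suc) i)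

gcdAll-cong : ∀ {u v : Vector ℕ n} → (∀ i → u i ≡ v i) → gcdAll u ≡ gcdAll v
gcdAll-cong {zero}  u≗v = refl
gcdAll-cong {suc n} u≗v = cong₂ gcd (u≗v zero) (gcdAll-cong (u≗v ∘ suc))

gcdAll-*ˡ : ∀ c (w : Vector ℕ n) → gcdAll (λ i → c * w i) ≡ c * gcdAll w
gcdAll-*ˡ {zero}  c w = sym (*-zeroʳ c)
gcdAll-*ˡ {suc n} c w = trans (cong (gcd (c * w zero)) (gcdAll-*ˡ c (w ∘ suc)))
                              (sym (c*gcd[m,n]≡gcd[cm,cn] c (w zero) (gcdAll (w ∘ suc))))

⟨,⟩-*ʳ : ∀ (c w : Vector ℕ n) d → ⟨ c , (λ i → w i * d) ⟩ ≡ ⟨ c , w ⟩ * d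
⟨,⟩-*ʳ {zero}  c w d = refl
⟨,⟩-*ʳ {suc n} c w d = begin
  c zero * (w zero * d) + ⟨ c ∘ suc , (λ i → w (suc i) * d) ⟩
    ≡⟨ cong₂ _+_ (sym (*-assoc (c zero) (w zero) d)) (⟨,⟩-*ʳ (c ∘ suc) (w ∘ suc) d) ⟩
  c zero * w zero * d + ⟨ c ∘ suc , w ∘ suc ⟩ * d
    ≡⟨ *-distribʳ-+ d (c zero * w zero) _ ⟨
  ⟨ c , w ⟩ * d
    ∎
  where open ≡-Reasoning

gcdAll-pos : ∀ (v : Vector ℕ n) i → 0 < v i → 0 < gcdAll v
gcdAll-pos v i vi>0 = n≢0⇒n>0 λ gcd≡0 → >⇒≢ vi>0 (ℕ.0∣⇒≡0 (subst (ℕ._∣ v i) gcd≡0 (gcdAll-∣ v i)))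

module DivideByGcd (v : Vector ℕ n) (d : ℕ) .{{_ : NonZero d}} (d≡gcd : d ≡ gcdAll v) where

  w : Vector ℕ n
  w i = v i / d

  v≡w*d : ∀ i → v i ≡ w i * d
  v≡w*d i = sym (m/n*n≡m (subst (ℕ._∣ v i) (sym d≡gcd) (gcdAll-∣ v i)))

  gcd[w]≡1 : gcdAll w ≡ 1
  gcd[w]≡1 = *-cancelˡ-≡ (gcdAll w) 1 d (begin
    d * gcdAll w              ≡⟨ gcdAll-*ˡ d w ⟨
    gcdAll (λ i → d * w i)    ≡⟨ gcdAll-cong (λ i → trans (*-comm d (w i)) (sym (v≡w*d i))) ⟩
    gcdAll v                  ≡⟨ d≡gcd ⟨
    d                         ≡⟨ *-identityʳ d ⟨
    d * 1                     ∎)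
    where open ≡-Reasoning

  w-<-reflects : ∀ {i j} → v i < v j → w i < w j
  w-<-reflects {i} {j} vi<vj = *-cancelʳ-< d (w i) (w j) (subst₂ _<_ (v≡w*d i) (v≡w*d j) vi<vj)

  0<v⇒0<w : ∀ {i} → 0 < v i → 0 < w i
  0<v⇒0<w {i} vi>0 = *-cancelʳ-< d 0 (w i) (subst (0 <_) (v≡w*d i) vi>0)

module _ where
  open import Data.Integer.Base as ℤ using (ℤ; +_; -_; _-_)
  import Data.Integer.Properties as ℤ
  open import Data.Integer.Tactic.RingSolver using (solve-∀)

  i-j<k⇒i<k+j : ∀ {i j k} → i - j ℤ.< k → i ℤ.< k ℤ.+ j
  i-j<k⇒i<k+j {i} {j} {k} i-j<k = subst (ℤ._< k ℤ.+ j) (i-j+j≡i i j) (ℤ.+-monoˡ-< j i-j<k)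
    where
    i-j+j≡i : ∀ i j → i - j ℤ.+ j ≡ i
    i-j+j≡i = solve-∀

  i-j<-k⇒i+k<j : ∀ {i j k} → i - j ℤ.< - k → i ℤ.+ k ℤ.< j
  i-j<-k⇒i+k<j {i} {j} {k} i-j<-k =
    subst (i ℤ.+ k ℤ.<_) (-k+j+k≡j k j) (ℤ.+-monoˡ-< k (i-j<k⇒i<k+j {i} {j} i-j<-k))
    where
    -k+j+k≡j : ∀ k j → - k ℤ.+ j ℤ.+ k ≡ j
    -k+j+k≡j = solve-∀

  [+a-+b]*+d≡+ad-+bd : ∀ a b d → (+ a - + b) ℤ.* + d ≡ + (a * d) - + (b * d)
  [+a-+b]*+d≡+ad-+bd a b d = begin
    (+ a - + b) ℤ.* + d               ≡⟨ ℤ.*-distribʳ-+ (+ d) (+ a) (- + b) ⟩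
    + a ℤ.* + d ℤ.+ - + b ℤ.* + d     ≡⟨ cong₂ ℤ._+_ (ℤ.pos-* a d) (ℤ.neg-distribˡ-* (+ b) (+ d)) ⟨
    + (a * d) ℤ.+ - (+ b ℤ.* + d)     ≡⟨ cong (λ i → + (a * d) - i) (ℤ.pos-* b d) ⟨
    + (a * d) - + (b * d)             ∎
    where open ≡-Reasoning

  +ad-+bd<Nd⇒+a-+b<N : ∀ a b d N → + (a * d) - + (b * d) ℤ.< N ℤ.* + d → + a - + b ℤ.< N
  +ad-+bd<Nd⇒+a-+b<N a b d N h =
    ℤ.*-cancelʳ-<-nonNeg (+ d) (subst (ℤ._< N ℤ.* + d) (sym ([+a-+b]*+d≡+ad-+bd a b d)) h)

-- The coprime case and the theorem

module Coprime {m : ℕ} (w : Vector ℕ (suc (suc m)))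
  (w-decreasing : ∀ i j → i F.< j → w j < w i) (w-last-pos : 0 < w (fromℕ (suc m)))
  (gcd≡1 : gcdAll w ≡ 1) where

  k A M : ℕ
  k = suc (suc m)
  A = w zero
  M = w (suc zero)

  w-pos : ∀ i → 0 < w i
  w-pos i with i ≟ fromℕ (suc m)
  ... | yes refl = w-last-pos
  ... | no  i≢last = <-trans w-last-pos (w-decreasing i (fromℕ (suc m)) (≤∧≢⇒< (≤fromℕ i) i≢last))

  instance
    A≢0 : NonZero A
    A≢0 = >-nonZero (w-pos zero)

  open ℤ/ A
  open Sumsets isAbelianGroup

  B : Fin k → Fin A
  B = ι ∘ w

  toℕ-B : ∀ i → toℕ (B (suc i)) ≡ w (suc i)
  toℕ-B i = trans (toℕ-ι (w (suc i))) (m<n⇒m%n≡m (w-decreasing zero (suc i) z<s))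

  B[1+i]≢B₀ : ∀ i → B (suc i) ≢ B zero
  B[1+i]≢B₀ i Bᵢ≡B₀ = >⇒≢ (w-pos (suc i)) (ι≡0ₘ∧<A⇒≡0 (trans Bᵢ≡B₀ ι-A≡0ₘ) (w-decreasing zero (suc i) z<s))

  B-injective : Injective _≡_ _≡_ B
  B-injective {zero}  {zero}  _     = refl
  B-injective {zero}  {suc j} B₀≡Bⱼ = contradiction (sym B₀≡Bⱼ) (B[1+i]≢B₀ j)
  B-injective {suc i} {zero}  Bᵢ≡B₀ = contradiction Bᵢ≡B₀ (B[1+i]≢B₀ i)
  B-injective {suc i} {suc j} Bᵢ≡Bⱼ =
    decreasing⇒injective w-decreasing (trans (sym (toℕ-B i)) (trans (cong toℕ Bᵢ≡Bⱼ) (toℕ-B j)))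

  open Erosion B (zero , ι-A≡0ₘ) B-injective (coprime-generates w gcd≡1)

  j : ℕ
  j = A / k

  A<[1+j]*k : A < suc j * k
  A<[1+j]*k = begin-strict
    A             ≡⟨ m≡m%n+[m/n]*n A k ⟩
    A % k + j * k <⟨ +-monoˡ-< (j * k) (m%n<n A k) ⟩
    k + j * k     ∎
    where open ≤-Reasoning

  w≤M : ∀ i → w (suc i) ≤ M
  w≤M zero    = ≤-refl
  w≤M (suc i) = <⇒≤ (w-decreasing (suc zero) (suc (suc i)) (s<s z<s))

  small-representative : ∀ h {z} → z ∈ h ·B → ∃ λ c → ι ⟨ c , w ⟩ ≡ z × ⟨ c , w ⟩ ≤ h * M
  small-representative zero {z} z∈⁅ε⁆ =
    (λ _ → 0) , trans (cong ι (sum-replicate-zero k)) (sym (x∈⁅y⁆⇒x≡y z∈⁅ε⁆)) , ≤-reflexive (sum-replicate-zero k)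
  small-representative (suc h) {z} z∈ = extend (x∈X⊕B⁻ {B = B} z∈)
    where
    open ≡-Reasoning
    -- B zero = 0ₘ adds nothing, so only the generators w (suc i) ≤ M are ever added.
    extend : (∃ λ i → z +ₘ -ₘ B i ∈ h ·B) → ∃ λ c → ι ⟨ c , w ⟩ ≡ z × ⟨ c , w ⟩ ≤ suc h * M
    extend (zero , z∙B₀⁻¹∈h·B) =
      let c , ι⟨c,w⟩≡z∙B₀⁻¹ , ⟨c,w⟩≤hM = small-representative h z∙B₀⁻¹∈h·B
      in c , trans ι⟨c,w⟩≡z∙B₀⁻¹ (trans (cong (λ b → z +ₘ -ₘ b) ι-A≡0ₘ) (x∙ε⁻¹≡x z)) ,
         ≤-trans ⟨c,w⟩≤hM (m≤n+m (h * M) M)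
    extend (suc i , z∙Bᵢ⁻¹∈h·B) =
      let c , ι⟨c,w⟩≡z∙Bᵢ⁻¹ , ⟨c,w⟩≤hM = small-representative h z∙Bᵢ⁻¹∈h·B
          ⟨c′,w⟩≡wᵢ+⟨c,w⟩ = trans (⟨,⟩-updateAt c w (suc i) 1) (cong (_+ ⟨ c , w ⟩) (*-identityˡ (w (suc i))))
      in updateAt c (suc i) suc ,
         (begin
           ι ⟨ updateAt c (suc i) suc , w ⟩  ≡⟨ cong ι ⟨c′,w⟩≡wᵢ+⟨c,w⟩ ⟩
           ι (w (suc i) + ⟨ c , w ⟩)         ≡⟨ ι-+ (w (suc i)) ⟨ c , w ⟩ ⟩
           B (suc i) +ₘ ι ⟨ c , w ⟩          ≡⟨ cong (B (suc i) +ₘ_) ι⟨c,w⟩≡z∙Bᵢ⁻¹ ⟩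
           B (suc i) +ₘ (z +ₘ -ₘ B (suc i))  ≡⟨ +ₘ-comm (B (suc i)) _ ⟩
           z +ₘ -ₘ B (suc i) +ₘ B (suc i)    ≡⟨ x∙y⁻¹∙y≡x z (B (suc i)) ⟩
           z                                ∎) ,
         ≤-trans (≤-reflexive ⟨c′,w⟩≡wᵢ+⟨c,w⟩) (+-mono-≤ (w≤M i) ⟨c,w⟩≤hM)

  open import Data.Integer.Base as ℤ using (-[1+_]; _-_)
  open import Data.Integer.Properties using (drop‿+<+)

  every-residue-small : ∀ z → ∃ λ c → ι ⟨ c , w ⟩ ≡ z × ⟨ c , w ⟩ ≤ 2 * j * M
  every-residue-small z =
    let c , ι⟨c,w⟩≡z , ⟨c,w⟩≤[j+j]M = small-representative (j + j) (·B-full j A<[1+j]*k z)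
    in c , ι⟨c,w⟩≡z , subst (⟨ c , w ⟩ ≤_) (cong (λ i → (j + i) * M) (sym (+-identityʳ j))) ⟨c,w⟩≤[j+j]M

  open import Data.Integer.Base as ℤ using (-[1+_]; _-_)
  open import Data.Integer.Properties using (drop‿+<+)

  representable : ∀ N → ℤ.+ (2 * j * M) - ℤ.+ A ℤ.< N → ∃ λ c → ℤ.+ ⟨ c , w ⟩ ≡ N
  representable (ℤ.+ x) bound =
    let c , ι⟨c,w⟩≡ιx , ⟨c,w⟩≤2jM = every-residue-small (ι x)
        t , x≡⟨c,w⟩+tA = ι≡ι∧<⇒≡+* ι⟨c,w⟩≡ιx (≤-<-trans ⟨c,w⟩≤2jM 2jM<x+A)
    in updateAt c zero (t +_) , cong ℤ.+_ (begin
      ⟨ updateAt c zero (t +_) , w ⟩  ≡⟨ ⟨,⟩-updateAt c w zero t ⟩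
      t * A + ⟨ c , w ⟩               ≡⟨ +-comm (t * A) ⟨ c , w ⟩ ⟩
      ⟨ c , w ⟩ + t * A               ≡⟨ x≡⟨c,w⟩+tA ⟨
      x                               ∎)
    where
    open ≡-Reasoning
    2jM<x+A : 2 * j * M < x + A
    2jM<x+A = drop‿+<+ (i-j<k⇒i<k+j {ℤ.+ (2 * j * M)} {ℤ.+ A} bound)
  representable -[1+ x ] bound =
    let c , ι⟨c,w⟩≡-ι[1+x] , ⟨c,w⟩≤2jM = every-residue-small (-ₘ ι (suc x))
    in contradiction
         (ι≡0ₘ∧<A⇒≡0 (ι[r+1+x]≡0ₘ ι⟨c,w⟩≡-ι[1+x]) (≤-<-trans (+-monoˡ-≤ (suc x) ⟨c,w⟩≤2jM) 2jM+1+x<A))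
         (m+1+n≢0 ⟨ c , w ⟩)
    where
    2jM+1+x<A : 2 * j * M + suc x < A
    2jM+1+x<A = drop‿+<+ (i-j<-k⇒i+k<j {ℤ.+ (2 * j * M)} {ℤ.+ A} bound)
    ι[r+1+x]≡0ₘ : ∀ {r} → ι r ≡ -ₘ ι (suc x) → ι (r + suc x) ≡ 0ₘ
    ι[r+1+x]≡0ₘ {r} ιr≡-ι[1+x] = begin
      ι (r + suc x)                ≡⟨ ι-+ r (suc x) ⟩
      ι r +ₘ ι (suc x)             ≡⟨ cong (_+ₘ ι (suc x)) ιr≡-ι[1+x] ⟩
      -ₘ ι (suc x) +ₘ ι (suc x)    ≡⟨ +ₘ-comm (-ₘ ι (suc x)) (ι (suc x)) ⟩
      ι (suc x) +ₘ -ₘ ι (suc x)    ≡⟨ +ₘ-inverseʳ (ι (suc x)) ⟩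
      0ₘ                           ∎
      where open ≡-Reasoning

module ScaledCoprime {m : ℕ} (v : Vector ℕ (suc (suc m)))
  (v-decreasing : ∀ i j → i F.< j → v j < v i) (v-last-pos : 0 < v (fromℕ (suc m)))
  (d : ℕ) (d≡gcd : d ≡ gcdAll v) where

  instance
    d≢0 : NonZero d
    d≢0 = >-nonZero (subst (0 <_) (sym d≡gcd) (gcdAll-pos v _ v-last-pos))

  open DivideByGcd v d d≡gcd public
  open Coprime w (λ i j → w-<-reflects ∘ v-decreasing i j) (0<v⇒0<w v-last-pos) gcd[w]≡1 public

  instance
    dk≢0 : NonZero (d * k)
    dk≢0 = m*n≢0 d k

  v₀div[dk]≡j : v zero div (d * k) ≡ j
  v₀div[dk]≡j = begin
    v zero div (d * k)  ≡⟨ div≡/ (v zero) (d * k) ⟩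
    v zero / (d * k)    ≡⟨ cong (_/ (d * k)) (trans (v≡w*d zero) (*-comm A d)) ⟩
    (d * A) / (d * k)   ≡⟨ m*n/m*o≡n/o d A k ⟩
    A / k               ∎
    where open ≡-Reasoning

  2[v₀div[dk]]v₁≡2jMd : 2 * (v zero div (d * k)) * v (suc zero) ≡ 2 * j * M * d
  2[v₀div[dk]]v₁≡2jMd = begin
    2 * (v zero div (d * k)) * v (suc zero) ≡⟨ cong₂ (λ a b → 2 * a * b) v₀div[dk]≡j (v≡w*d (suc zero)) ⟩
    2 * j * (M * d)                         ≡⟨ *-assoc (2 * j) M d ⟨
    2 * j * M * d                           ∎
    where open ≡-Reasoning

  ⟨c,v⟩≡⟨c,w⟩*d : ∀ c → ⟨ c , v ⟩ ≡ ⟨ c , w ⟩ * d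
  ⟨c,v⟩≡⟨c,w⟩*d c = trans (⟨,⟩-cong c v≡w*d) (⟨,⟩-*ʳ c w d)

open import Data.Nat using (ℕ; suc; _>_)
open import Data.Integer using (ℤ; +_; _-_)
open import Data.Integer.Divisibility using (_∣_)
open import Data.Integer.Divisibility.Signed using (∣ᵤ⇒∣; divides)
open import Data.Integer.Properties using (pos-*)
open import Data.Fin using (Fin; zero; suc; fromℕ)
open import Data.Vec.Functional using (Vector; foldr; zipWith)
open import Data.Product using (∃)
open import Relation.Binary.PropositionalEquality using (_≡_)
import Data.Nat as N
import Data.Fin as F
import Data.Integer as Z

corollary1 : (m : ℕ) → let k = suc (suc m) in (v : Vector ℕ k) →
  (∀ (i j : Fin k) → i F.< j → v j N.< v i) →
  v (fromℕ (suc m)) > 0 →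
  (d : ℕ) → d ≡ gcdAll v →
  (n : ℤ) → + (2 N.* (v zero div (d N.* k)) N.* v (suc zero)) - + (v zero) Z.< n →
  + d ∣ n →
  ∃ λ (c : Vector ℕ k) → + (foldr N._+_ 0 (zipWith N._*_ c v)) ≡ n
corollary1 m v v-decreasing v-last-pos d d≡gcd n bound d∣n with divides N n≡N*d ← ∣ᵤ⇒∣ d∣n =
  c , (begin
    + ⟨ c , v ⟩          ≡⟨ cong +_ (⟨c,v⟩≡⟨c,w⟩*d c) ⟩
    + (⟨ c , w ⟩ N.* d)  ≡⟨ pos-* ⟨ c , w ⟩ d ⟩
    + ⟨ c , w ⟩ Z.* + d  ≡⟨ cong (Z._* + d) ⟨c,w⟩≡N ⟩
    N Z.* + d            ≡⟨ n≡N*d ⟨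
    n                    ∎)
  where
  open ≡-Reasoning
  open ScaledCoprime v v-decreasing v-last-pos d d≡gcd

  N-bound : + (2 N.* j N.* M) - + A Z.< N
  N-bound = +ad-+bd<Nd⇒+a-+b<N (2 N.* j N.* M) A d N
    (subst₂ (λ a b → + a - + b Z.< N Z.* + d) 2[v₀div[dk]]v₁≡2jMd (v≡w*d zero) (subst (_ Z.<_) n≡N*d bound))

  c : Vector ℕ k
  c = proj₁ (representable N N-bound)

  ⟨c,w⟩≡N : + ⟨ c , w ⟩ ≡ N
  ⟨c,w⟩≡N = proj₂ (representable N N-bound)
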